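{- Let $t\ge 2$ and $n\ge t+1$ be integers, $N=n-t$, and let $\Delta:[1-t,n-t]\to\{0,1\}$ be a $2$-coloring. Let $a=|\Delta^{ -1}(0)\cap[1-t,-1]|$, $q=|\Delta^{ -1}(0)\cap[1,N]|$, let $\varepsilon=1$ if $\Delta(0)=0$ and $\varepsilon=0$ otherwise, and set $s_0=a+\varepsilon$, $s_1=t-a-\varepsilon$. Let $N_{QQP}$ be the number of triples $(x_1,x_2,x_3)$ with $x_1,x_2\in[1-t,0]$, $x_3\in[1,N]$, $x_1\le x_2\le x_3$, $x_1+x_2<x_3$ and $\Delta(x_1)=\Delta(x_2)=\Delta(x_3)$. Then \[ N_{QQP}=\binom{s_0+1}{2}\,q+\binom{s_1+1}{2}\,(N-q). \]
   Context: For integers $a\le b$, $[a,b]=\{m\in\mathbb Z:a\le m\le b\}$. -}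

module Defs where

open import Data.Nat using (ℕ; zero; suc)
open import Data.Integer using (ℤ; +_; -[1+_]; _-_; _+_; _≤_; _<_; _≤?_; _<?_)
open import Data.Fin using (Fin)
import Data.Fin as Fin
open import Data.Fin.Properties using (_≟_)
open import Data.List using (List; []; _∷_; length; filter; concatMap)
open import Data.Product using (_×_; _,_)
open import Relation.Nullary using (_×-dec_)
open import Relation.Binary.PropositionalEquality using (_≡_)

range : ℤ → ℕ → List ℤ
range k zero = []
range k (suc m) = k ∷ range (k + + 1) m

clamp : ℤ → ℕ
clamp (+ k) = k
clamp -[1+ _ ] = 0

interval : ℤ → ℤ → List ℤ
interval a b = range a (clamp ((b + + 1) - a))

countColour : (ℤ → Fin 2) → Fin 2 → ℤ → ℤ → ℕ
countColour Δ c a b = length (filter (λ x → Δ x ≟ c) (interval a b))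

triples : ℤ → ℤ → ℤ → ℤ → List (ℤ × ℤ × ℤ)
triples lo₁ hi₁ lo₃ hi₃ =
  concatMap (λ x₁ → concatMap (λ x₂ → Data.List.map (λ x₃ → x₁ , x₂ , x₃) (interval lo₃ hi₃))
                               (interval lo₁ hi₁))
            (interval lo₁ hi₁)

QQPcond : (ℤ → Fin 2) → ℤ × ℤ × ℤ → Set
QQPcond Δ (x₁ , x₂ , x₃) =
  (x₁ ≤ x₂) × (x₂ ≤ x₃) × (x₁ + x₂ < x₃) × (Δ x₁ ≡ Δ x₂) × (Δ x₂ ≡ Δ x₃)

QQPcond? : (Δ : ℤ → Fin 2) → (p : ℤ × ℤ × ℤ) → Relation.Nullary.Dec (QQPcond Δ p)
QQPcond? Δ (x₁ , x₂ , x₃) =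
  (x₁ ≤? x₂) ×-dec (x₂ ≤? x₃) ×-dec (x₁ + x₂ <? x₃) ×-dec (Δ x₁ ≟ Δ x₂) ×-dec (Δ x₂ ≟ Δ x₃)

NQQP : (Δ : ℤ → Fin 2) → (t N : ℕ) → ℕ
NQQP Δ t N = length (filter (QQPcond? Δ) (triples (+ 1 - + t) (+ 0) (+ 1) (+ N)))

epsilon : (ℤ → Fin 2) → ℕ
epsilon Δ with Δ (+ 0) ≟ Fin.zero
... | Relation.Nullary.yes _ = 1
... | Relation.Nullary.no _ = 0

{-# OPTIONS --safe #-}
module Submission where

-- Since x₁, x₂ ≤ 0 < x₃, the conditions x₂ ≤ x₃ and x₁ + x₂ < x₃ hold automatically, so an
-- N_QQP triple is a monochromatic pair x₁ ≤ x₂ in [1-t, 0] together with a point x₃ of the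
-- same colour in [1, N]. A colour class of size s in [1-t, 0] contains C(s+1, 2) such pairs
-- (a new minimum forms s + 1 new pairs), and the colour classes have sizes
-- s₀ = a + ε, s₁ = t - s₀ in [1-t, 0] and q, N - q in [1, N].

open import Defs
open import Data.Nat using (ℕ; _+_; _*_; _∸_; _≤_)
open import Data.Nat.Combinatorics using (_C_)
open import Data.Integer using (ℤ; -_) renaming (+_ to ⁺_; _+_ to _+ℤ_; _-_ to _-ℤ_)
open import Data.Fin using (Fin; zero)
open import Relation.Binary.PropositionalEquality using (_≡_)

open import Data.Nat using (suc; s≤s; z≤n)
import Data.Nat.Properties as ℕ
open import Algebra.Properties.CommutativeSemigroup ℕ.+-commutativeSemigroup using (interchange; x∙yz≈y∙xz)
open import Data.Nat.Combinatorics using (nCk+nC[k+1]≡[n+1]C[k+1]; nC1≡n)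
open import Data.Nat.ListAction using (sum)
open import Data.Integer using (-[1+_]; +≤+) renaming (_≤_ to _≤ℤ_; _<_ to _<ℤ_)
import Data.Integer.Properties as ℤ
open import Data.Fin using () renaming (suc to fsuc)
open import Data.Fin.Properties using (_≟_; 0≢1+n)
open import Data.List using (List; []; _∷_; _++_; length; filter; map; concatMap)
open import Data.List.Properties using (filter-accept; filter-reject; filter-none; filter-++; length-++; map-cong)
open import Data.List.Relation.Unary.All as All using (All; []; _∷_)
import Data.List.Relation.Unary.All.Properties as All
open import Data.List.Relation.Unary.AllPairs using (AllPairs; []; _∷_)
open import Data.Product using (_×_; _,_)
open import Function using (_∘_; _⇔_; mk⇔; Equivalence)
open import Relation.Nullary using (¬_; yes; no)
open import Relation.Unary using (Decidable)
open import Relation.Binary.PropositionalEquality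
  using (refl; sym; trans; cong; cong₂; subst; module ≡-Reasoning)
open ≡-Reasoning

length-filter-concatMap : ∀ {A B : Set} {P : B → Set} (P? : Decidable P) (f : A → List B) xs →
  length (filter P? (concatMap f xs)) ≡ sum (map (λ x → length (filter P? (f x))) xs)
length-filter-concatMap P? f [] = refl
length-filter-concatMap P? f (x ∷ xs) = begin
  length (filter P? (f x ++ concatMap f xs))
    ≡⟨ cong length (filter-++ P? (f x) (concatMap f xs)) ⟩
  length (filter P? (f x) ++ filter P? (concatMap f xs))
    ≡⟨ length-++ (filter P? (f x)) ⟩
  length (filter P? (f x)) + length (filter P? (concatMap f xs))
    ≡⟨ cong (length (filter P? (f x)) +_) (length-filter-concatMap P? f xs) ⟩
  length (filter P? (f x)) + sum (map (λ x → length (filter P? (f x))) xs) ∎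

length-filter-map : ∀ {A B : Set} {P : B → Set} {Q : A → Set} (P? : Decidable P) (Q? : Decidable Q)
  (f : A → B) {xs} → All (λ x → P (f x) ⇔ Q x) xs →
  length (filter P? (map f xs)) ≡ length (filter Q? xs)
length-filter-map P? Q? f [] = refl
length-filter-map P? Q? f {x ∷ xs} (P⇔Q ∷ rest) with Q? x
... | yes q = trans (cong length (filter-accept P? (Equivalence.from P⇔Q q)))
                    (cong suc (length-filter-map P? Q? f rest))
... | no ¬q = trans (cong length (filter-reject P? (¬q ∘ Equivalence.to P⇔Q)))
                    (length-filter-map P? Q? f rest)

sum-map-+ : ∀ {A : Set} (f g : A → ℕ) xs →
  sum (map (λ x → f x + g x) xs) ≡ sum (map f xs) + sum (map g xs)
sum-map-+ f g [] = refl
sum-map-+ f g (x ∷ xs) = begin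
  f x + g x + sum (map (λ x → f x + g x) xs)     ≡⟨ cong (f x + g x +_) (sum-map-+ f g xs) ⟩
  f x + g x + (sum (map f xs) + sum (map g xs)) ≡⟨ interchange (f x) (g x) _ _ ⟩
  f x + sum (map f xs) + (g x + sum (map g xs)) ∎

[1+n]C2≡n+nC2 : ∀ n → suc n C 2 ≡ n + n C 2
[1+n]C2≡n+nC2 n = trans (sym (nCk+nC[k+1]≡[n+1]C[k+1] n 1)) (cong (_+ n C 2) (nC1≡n n))

i<i+1 : ∀ i → i <ℤ i +ℤ ⁺ 1
i<i+1 i = ℤ.suc[i]≤j⇒i<j (ℤ.≤-reflexive (ℤ.+-comm (⁺ 1) i))

length-range : ∀ k m → length (range k m) ≡ m
length-range k 0    = refl
length-range k (suc m) = cong suc (length-range (k +ℤ ⁺ 1) m)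

range-lowerBound : ∀ k m → All (k ≤ℤ_) (range k m)
range-lowerBound k 0    = []
range-lowerBound k (suc m) =
  ℤ.≤-refl ∷ All.map (ℤ.≤-trans (ℤ.<⇒≤ (i<i+1 k))) (range-lowerBound (k +ℤ ⁺ 1) m)

range-upperBound : ∀ k m → All (_<ℤ k +ℤ ⁺ m) (range k m)
range-upperBound k 0    = []
range-upperBound k (suc m) =
  ℤ.<-≤-trans (i<i+1 k) (ℤ.+-monoʳ-≤ k (+≤+ (s≤s z≤n))) ∷
  subst (λ b → All (_<ℤ b) (range (k +ℤ ⁺ 1) m)) (ℤ.+-assoc k (⁺ 1) (⁺ m))
        (range-upperBound (k +ℤ ⁺ 1) m)

range-increasing : ∀ k m → AllPairs _<ℤ_ (range k m)
range-increasing k 0    = []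
range-increasing k (suc m) =
  All.map (ℤ.<-≤-trans (i<i+1 k)) (range-lowerBound (k +ℤ ⁺ 1) m) ∷ range-increasing (k +ℤ ⁺ 1) m

range-suc : ∀ k m → range k (suc m) ≡ range k m ++ k +ℤ ⁺ m ∷ []
range-suc k 0    = cong (_∷ []) (sym (ℤ.+-identityʳ k))
range-suc k (suc m) = cong (k ∷_) (begin
  range (k +ℤ ⁺ 1) (suc m)                     ≡⟨ range-suc (k +ℤ ⁺ 1) m ⟩
  range (k +ℤ ⁺ 1) m ++ k +ℤ ⁺ 1 +ℤ ⁺ m ∷ []  ≡⟨ cong (λ b → range (k +ℤ ⁺ 1) m ++ b ∷ [])
                                                      (ℤ.+-assoc k (⁺ 1) (⁺ m)) ⟩
  range (k +ℤ ⁺ 1) m ++ k +ℤ ⁺ suc m ∷ []      ∎)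

length-interval-from-1 : ∀ N → length (interval (⁺ 1) (⁺ N)) ≡ N
length-interval-from-1 N = begin
  length (range (⁺ 1) (clamp (⁺ (N + 1) -ℤ ⁺ 1))) ≡⟨ length-range (⁺ 1) _ ⟩
  clamp (⁺ (N + 1) -ℤ ⁺ 1)                        ≡⟨ cong clamp (ℤ.⊖-≥ (ℕ.m≤n+m 1 N)) ⟩
  N + 1 ∸ 1                                         ≡⟨ ℕ.m+n∸n≡m N 1 ⟩
  N                                                 ∎

interval-from-1-positive : ∀ N → All (⁺ 0 <ℤ_) (interval (⁺ 1) (⁺ N))
interval-from-1-positive N = All.map ℤ.suc[i]≤j⇒i<j (range-lowerBound (⁺ 1) _)

nonpositiveRange-split : ∀ v → range -[1+ v ] (suc (suc v)) ≡ range -[1+ v ] (suc v) ++ ⁺ 0 ∷ []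
nonpositiveRange-split v = trans (range-suc -[1+ v ] (suc v))
  (cong (λ b → range -[1+ v ] (suc v) ++ b ∷ []) (ℤ.+-inverseˡ (⁺ suc v)))

nonpositiveRange-≤0 : ∀ v → All (_≤ℤ ⁺ 0) (range -[1+ v ] (suc (suc v)))
nonpositiveRange-≤0 v = subst (All (_≤ℤ ⁺ 0)) (sym (nonpositiveRange-split v))
  (All.++⁺ (All.map ℤ.<⇒≤ negatives<0) (ℤ.≤-refl ∷ []))
  where
  negatives<0 : All (_<ℤ ⁺ 0) (range -[1+ v ] (suc v))
  negatives<0 = subst (λ b → All (_<ℤ b) (range -[1+ v ] (suc v))) (ℤ.+-inverseˡ (⁺ suc v))
                      (range-upperBound -[1+ v ] (suc v))

colourCount : (ℤ → Fin 2) → Fin 2 → List ℤ → ℕ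
colourCount Δ c xs = length (filter (λ x → Δ x ≟ c) xs)

module _ (Δ : ℤ → Fin 2) where

  colourCount-here : ∀ {c y} ys → Δ y ≡ c → colourCount Δ c (y ∷ ys) ≡ suc (colourCount Δ c ys)
  colourCount-here ys Δy≡c = cong length (filter-accept (λ x → Δ x ≟ _) {xs = ys} Δy≡c)

  colourCount-there : ∀ {c y} ys → ¬ Δ y ≡ c → colourCount Δ c (y ∷ ys) ≡ colourCount Δ c ys
  colourCount-there ys Δy≢c = cong length (filter-reject (λ x → Δ x ≟ _) {xs = ys} Δy≢c)

  colourCount-++ : ∀ c xs ys → colourCount Δ c (xs ++ ys) ≡ colourCount Δ c xs + colourCount Δ c ys
  colourCount-++ c xs ys =
    trans (cong length (filter-++ (λ x → Δ x ≟ c) xs ys)) (length-++ (filter (λ x → Δ x ≟ c) xs))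

  colourCount-partition : ∀ xs → colourCount Δ zero xs + colourCount Δ (fsuc zero) xs ≡ length xs
  colourCount-partition [] = refl
  colourCount-partition (x ∷ xs) with Δ x
  ... | zero      = cong suc (colourCount-partition xs)
  ... | fsuc zero = trans (ℕ.+-suc _ _) (cong suc (colourCount-partition xs))

  colourCount-one : ∀ xs → colourCount Δ (fsuc zero) xs ≡ length xs ∸ colourCount Δ zero xs
  colourCount-one xs = begin
    k₁                ≡⟨ ℕ.m+n∸m≡n k₀ k₁ ⟨
    k₀ + k₁ ∸ k₀      ≡⟨ cong (_∸ k₀) (colourCount-partition xs) ⟩
    length xs ∸ k₀    ∎
    where
    k₀ = colourCount Δ zero xs
    k₁ = colourCount Δ (fsuc zero) xs

  epsilon≡colourCount[0] : epsilon Δ ≡ colourCount Δ zero (⁺ 0 ∷ [])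
  epsilon≡colourCount[0] with Δ (⁺ 0) ≟ zero
  ... | yes _ = refl
  ... | no _  = refl

  colourCount-zero-nonpositiveRange : ∀ v →
    colourCount Δ zero (range -[1+ v ] (suc (suc v)))
      ≡ colourCount Δ zero (range -[1+ v ] (suc v)) + epsilon Δ
  colourCount-zero-nonpositiveRange v = begin
    colourCount Δ zero (range -[1+ v ] (suc (suc v)))
      ≡⟨ cong (colourCount Δ zero) (nonpositiveRange-split v) ⟩
    colourCount Δ zero (negatives ++ ⁺ 0 ∷ [])
      ≡⟨ colourCount-++ zero negatives _ ⟩
    colourCount Δ zero negatives + colourCount Δ zero (⁺ 0 ∷ [])
      ≡⟨ cong (colourCount Δ zero negatives +_) epsilon≡colourCount[0] ⟨
    colourCount Δ zero negatives + epsilon Δ ∎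
    where negatives = range -[1+ v ] (suc v)

module _ (Δ : ℤ → Fin 2) (M : List ℤ) where

  completions : ℤ → ℤ → ℕ
  completions x₁ x₂ = length (filter (QQPcond? Δ) (map (λ x₃ → x₁ , x₂ , x₃) M))

  completions-none : ∀ {x₁ x₂} → (∀ x₃ → ¬ QQPcond Δ (x₁ , x₂ , x₃)) → completions x₁ x₂ ≡ 0
  completions-none ¬QQP =
    cong length (filter-none (QQPcond? Δ) (All.map⁺ (All.universal ¬QQP M)))

  completions-bichromatic : ∀ {x₁ x₂} → ¬ Δ x₁ ≡ Δ x₂ → completions x₁ x₂ ≡ 0
  completions-bichromatic Δx₁≢Δx₂ =
    completions-none (λ { _ (_ , _ , _ , Δx₁≡Δx₂ , _) → Δx₁≢Δx₂ Δx₁≡Δx₂ })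

  completions-decreasing : ∀ {x₁ x₂} → x₂ <ℤ x₁ → completions x₁ x₂ ≡ 0
  completions-decreasing x₂<x₁ =
    completions-none (λ { _ (x₁≤x₂ , _) → ℤ.<⇒≱ x₂<x₁ x₁≤x₂ })

  completions-monochromatic : All (⁺ 0 <ℤ_) M → ∀ {x₁ x₂} → x₁ ≤ℤ ⁺ 0 → x₂ ≤ℤ ⁺ 0 →
    x₁ ≤ℤ x₂ → Δ x₁ ≡ Δ x₂ → completions x₁ x₂ ≡ colourCount Δ (Δ x₂) M
  completions-monochromatic M⁺ x₁≤0 x₂≤0 x₁≤x₂ Δx₁≡Δx₂ =
    length-filter-map (QQPcond? Δ) (λ x₃ → Δ x₃ ≟ _) _ (All.map QQP⇔sameColour M⁺)
    where
    QQP⇔sameColour : ∀ {x₃} → ⁺ 0 <ℤ x₃ → QQPcond Δ (_ , _ , x₃) ⇔ (Δ x₃ ≡ _)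
    QQP⇔sameColour 0<x₃ = mk⇔
      (λ { (_ , _ , _ , _ , Δx₂≡Δx₃) → sym Δx₂≡Δx₃ })
      (λ Δx₃≡Δx₂ → x₁≤x₂ , ℤ.≤-trans x₂≤0 (ℤ.<⇒≤ 0<x₃) ,
                    ℤ.≤-<-trans (ℤ.+-mono-≤ x₁≤0 x₂≤0) 0<x₃ , Δx₁≡Δx₂ , sym Δx₃≡Δx₂)

  completions-row : All (⁺ 0 <ℤ_) M → ∀ {y} ys → y ≤ℤ ⁺ 0 → All (y <ℤ_) ys → All (_≤ℤ ⁺ 0) ys →
    sum (map (completions y) ys) ≡ colourCount Δ (Δ y) ys * colourCount Δ (Δ y) M
  completions-row M⁺ [] _ [] [] = refl
  completions-row M⁺ {y} (x ∷ xs) y≤0 (y<x ∷ y<xs) (x≤0 ∷ xs≤0) with Δ x ≟ Δ y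
  ... | yes Δx≡Δy = cong₂ _+_
          (trans (completions-monochromatic M⁺ y≤0 x≤0 (ℤ.<⇒≤ y<x) (sym Δx≡Δy))
                 (cong (λ c → colourCount Δ c M) Δx≡Δy))
          (completions-row M⁺ xs y≤0 y<xs xs≤0)
  ... | no Δx≢Δy  = cong₂ _+_
          (completions-bichromatic (Δx≢Δy ∘ sym))
          (completions-row M⁺ xs y≤0 y<xs xs≤0)

  completions-column : ∀ {y} ys → All (y <ℤ_) ys → sum (map (λ x → completions x y) ys) ≡ 0
  completions-column [] [] = refl
  completions-column (x ∷ xs) (y<x ∷ y<xs) =
    cong₂ _+_ (completions-decreasing y<x) (completions-column xs y<xs)

  completionSum : List ℤ → ℕ
  completionSum W = sum (map (λ x₁ → sum (map (completions x₁) W)) W)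

  completionSum-cons : All (⁺ 0 <ℤ_) M → ∀ {y} ys → y ≤ℤ ⁺ 0 → All (y <ℤ_) ys → All (_≤ℤ ⁺ 0) ys →
    completionSum (y ∷ ys) ≡ suc (colourCount Δ (Δ y) ys) * colourCount Δ (Δ y) M + completionSum ys
  completionSum-cons M⁺ {y} ys y≤0 y<ys ys≤0 = begin
    (completions y y + sum (map (completions y) ys)) +
      sum (map (λ x → completions x y + sum (map (completions x) ys)) ys)
        ≡⟨ cong₂ _+_ (cong₂ _+_ (completions-monochromatic M⁺ y≤0 y≤0 ℤ.≤-refl refl)
                                (completions-row M⁺ ys y≤0 y<ys ys≤0))
                     (sum-map-+ (λ x → completions x y) _ ys) ⟩
    suc k * w + (sum (map (λ x → completions x y) ys) + completionSum ys)
        ≡⟨ cong (λ s → suc k * w + (s + completionSum ys)) (completions-column ys y<ys) ⟩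
    suc k * w + completionSum ys ∎
    where
    k = colourCount Δ (Δ y) ys
    w = colourCount Δ (Δ y) M

  colourTerm : Fin 2 → List ℤ → ℕ
  colourTerm c W = ((colourCount Δ c W + 1) C 2) * colourCount Δ c M

  QQPformula : List ℤ → ℕ
  QQPformula W = colourTerm zero W + colourTerm (fsuc zero) W

  colourTerm-here : ∀ {c y} ys → Δ y ≡ c →
    colourTerm c (y ∷ ys) ≡ suc (colourCount Δ c ys) * colourCount Δ c M + colourTerm c ys
  colourTerm-here {c} {y} ys Δy≡c = begin
    ((colourCount Δ c (y ∷ ys) + 1) C 2) * w  ≡⟨ cong (λ j → ((j + 1) C 2) * w) (colourCount-here Δ ys Δy≡c) ⟩
    ((suc k + 1) C 2) * w                      ≡⟨ cong (_* w) ([1+n]C2≡n+nC2 (k + 1)) ⟩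
    (k + 1 + (k + 1) C 2) * w                  ≡⟨ ℕ.*-distribʳ-+ w (k + 1) _ ⟩
    (k + 1) * w + ((k + 1) C 2) * w            ≡⟨ cong (λ j → j * w + ((k + 1) C 2) * w) (ℕ.+-comm k 1) ⟩
    suc k * w + ((k + 1) C 2) * w              ∎
    where
    k = colourCount Δ c ys
    w = colourCount Δ c M

  colourTerm-there : ∀ {c y} ys → ¬ Δ y ≡ c → colourTerm c (y ∷ ys) ≡ colourTerm c ys
  colourTerm-there {c} ys Δy≢c =
    cong (λ j → ((j + 1) C 2) * colourCount Δ c M) (colourCount-there Δ ys Δy≢c)

  QQPformula-cons : ∀ {c y} ys → Δ y ≡ c →
    QQPformula (y ∷ ys) ≡ suc (colourCount Δ c ys) * colourCount Δ c M + QQPformula ys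
  QQPformula-cons {zero} {y} ys Δy≡c = begin
    colourTerm zero (y ∷ ys) + colourTerm (fsuc zero) (y ∷ ys)
      ≡⟨ cong₂ _+_ (colourTerm-here ys Δy≡c)
                   (colourTerm-there ys (λ Δy≡1 → 0≢1+n (trans (sym Δy≡c) Δy≡1))) ⟩
    (new + colourTerm zero ys) + colourTerm (fsuc zero) ys
      ≡⟨ ℕ.+-assoc new _ _ ⟩
    new + QQPformula ys ∎
    where new = suc (colourCount Δ zero ys) * colourCount Δ zero M
  QQPformula-cons {fsuc zero} {y} ys Δy≡c = begin
    colourTerm zero (y ∷ ys) + colourTerm (fsuc zero) (y ∷ ys)
      ≡⟨ cong₂ _+_ (colourTerm-there ys (λ Δy≡0 → 0≢1+n (trans (sym Δy≡0) Δy≡c)))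
                   (colourTerm-here ys Δy≡c) ⟩
    colourTerm zero ys + (new + colourTerm (fsuc zero) ys)
      ≡⟨ x∙yz≈y∙xz (colourTerm zero ys) new _ ⟩
    new + QQPformula ys ∎
    where new = suc (colourCount Δ (fsuc zero) ys) * colourCount Δ (fsuc zero) M

  completionSum≡QQPformula : All (⁺ 0 <ℤ_) M → ∀ {W} → AllPairs _<ℤ_ W → All (_≤ℤ ⁺ 0) W →
    completionSum W ≡ QQPformula W
  completionSum≡QQPformula M⁺ [] [] = refl
  completionSum≡QQPformula M⁺ {y ∷ ys} (y<ys ∷ ys↑) (y≤0 ∷ ys≤0) = begin
    completionSum (y ∷ ys)     ≡⟨ completionSum-cons M⁺ ys y≤0 y<ys ys≤0 ⟩
    new + completionSum ys     ≡⟨ cong (new +_) (completionSum≡QQPformula M⁺ ys↑ ys≤0) ⟩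
    new + QQPformula ys        ≡⟨ QQPformula-cons ys refl ⟨
    QQPformula (y ∷ ys)        ∎
    where new = suc (colourCount Δ (Δ y) ys) * colourCount Δ (Δ y) M

  QQP-count : All (⁺ 0 <ℤ_) M → ∀ {W} → AllPairs _<ℤ_ W → All (_≤ℤ ⁺ 0) W →
    length (filter (QQPcond? Δ)
      (concatMap (λ x₁ → concatMap (λ x₂ → map (λ x₃ → x₁ , x₂ , x₃) M) W) W))
    ≡ QQPformula W
  QQP-count M⁺ {W} W↑ W≤0 = begin
    length (filter (QQPcond? Δ) (concatMap triplesFrom W))
      ≡⟨ length-filter-concatMap (QQPcond? Δ) triplesFrom W ⟩
    sum (map (λ x₁ → length (filter (QQPcond? Δ) (triplesFrom x₁))) W)
      ≡⟨ cong sum (map-cong (λ x₁ → length-filter-concatMap (QQPcond? Δ) (triplesWith x₁) W) W) ⟩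
    completionSum W
      ≡⟨ completionSum≡QQPformula M⁺ W↑ W≤0 ⟩
    QQPformula W ∎
    where
    triplesWith : ℤ → ℤ → List (ℤ × ℤ × ℤ)
    triplesWith x₁ x₂ = map (λ x₃ → x₁ , x₂ , x₃) M
    triplesFrom : ℤ → List (ℤ × ℤ × ℤ)
    triplesFrom x₁ = concatMap (triplesWith x₁) W

-- For t ≥ 2 the bound 1 - t computes to -[1+ t - 2 ], so [1-t, 0] and [1-t, -1] unfold to ranges
-- from it.
lemma4p3 : (t n : ℕ) → 2 ≤ t → t + 1 ≤ n → (Δ : ℤ → Fin 2) →
    let N = n ∸ t
        a = countColour Δ zero (⁺ 1 -ℤ ⁺ t) (- ⁺ 1)
        q = countColour Δ zero (⁺ 1) (⁺ N)
        ε = epsilon Δ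
        s₀ = a + ε
        s₁ = t ∸ a ∸ ε
    in NQQP Δ t N ≡ ((s₀ + 1) C 2) * q + ((s₁ + 1) C 2) * (N ∸ q)
lemma4p3 1 _ (s≤s ()) _ _
lemma4p3 t@(suc (suc v)) n _ _ Δ = begin
  NQQP Δ t N
    ≡⟨ QQP-count Δ M (interval-from-1-positive N) (range-increasing -[1+ v ] t) (nonpositiveRange-≤0 v) ⟩
  QQPformula Δ M W
    ≡⟨ cong₂ (λ s₀ s₁ → ((s₀ + 1) C 2) * q + ((s₁ + 1) C 2) * colourCount Δ (fsuc zero) M) W₀≡s₀ W₁≡s₁ ⟩
  ((a + ε + 1) C 2) * q + ((t ∸ a ∸ ε + 1) C 2) * colourCount Δ (fsuc zero) M
    ≡⟨ cong (λ r → ((a + ε + 1) C 2) * q + ((t ∸ a ∸ ε + 1) C 2) * r) M₁≡N∸q ⟩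
  ((a + ε + 1) C 2) * q + ((t ∸ a ∸ ε + 1) C 2) * (N ∸ q) ∎
  where
  N = n ∸ t
  M = interval (⁺ 1) (⁺ N)
  W = interval (⁺ 1 -ℤ ⁺ t) (⁺ 0)
  a = countColour Δ zero (⁺ 1 -ℤ ⁺ t) (- ⁺ 1)
  q = countColour Δ zero (⁺ 1) (⁺ N)
  ε = epsilon Δ

  W₀≡s₀ : colourCount Δ zero W ≡ a + ε
  W₀≡s₀ = colourCount-zero-nonpositiveRange Δ v

  W₁≡s₁ : colourCount Δ (fsuc zero) W ≡ t ∸ a ∸ ε
  W₁≡s₁ = begin
    colourCount Δ (fsuc zero) W             ≡⟨ colourCount-one Δ W ⟩
    length W ∸ colourCount Δ zero W         ≡⟨ cong₂ _∸_ (length-range -[1+ v ] t) W₀≡s₀ ⟩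
    t ∸ (a + ε)                             ≡⟨ ℕ.∸-+-assoc t a ε ⟨
    t ∸ a ∸ ε                               ∎

  M₁≡N∸q : colourCount Δ (fsuc zero) M ≡ N ∸ q
  M₁≡N∸q = trans (colourCount-one Δ M) (cong (_∸ q) (length-interval-from-1 N))
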